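{- Let $a\in E$ and let $\sigma$ be its associated permutation. Then $\mathrm{Std}(g(a))=\sigma^{ -1}$. In particular, two elements $a,b\in E$ satisfy $\mathrm{Std}(g(a))=\mathrm{Std}(g(b))$ if and only if they have the same associated permutation.
   Context: The standardization $\mathrm{Std}(w)$ of a word $w=w_1\dots w_n$ on positive integers is the permutation of $[n]$ obtained by scanning $w$ from left to right and replacing occurrences of the smallest letter by $1,2,\dots,k$, then occurrences of the second smallest by $k+1,\dots$, and so on. $E$ is the set of infinite sequences $a=(a_1,a_2,\dots)$ of nonnegative integers with finitely many nonzero entries such that the subword $a_{j_1}\dots a_{j_k}$ ($j_1<\dots<j_k$) of nonzero entries, called the associated permutation, is a permutation of $[k]$. For $a\in E$, $g(a)=w_1\dots w_k$ is the word defined by $w_{a_{j_1}}=j_1$ and, for $i=1,\dots,k-1$, $w_{a_{j_{i+1}}}=w_{a_{j_i}}+(j_{i+1}-j_i)-1$ if $a_{j_i}<a_{j_{i+1}}$ and $w_{a_{j_{i+1}}}=w_{a_{j_i}}+(j_{i+1}-j_i)$ otherwise; $g$ is a bijection from $E$ onto the set of finite words on positive integers, by which words are identified with elements of $E$ (so "the standardization of $a$" means $\mathrm{Std}(g(a))$). -}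

module Defs where

open import Data.Nat using (ℕ; zero; suc; _+_; _∸_; _<ᵇ_; _≡ᵇ_)
open import Data.Bool using (Bool; true; false; if_then_else_; _∧_)
open import Data.List using (List; []; _∷_; map; length; upTo; zip)
open import Data.Product using (_×_; _,_; proj₁; proj₂)
open import Data.List.Relation.Binary.Permutation.Propositional using (_↭_)

-- An element a ∈ E (an infinite sequence of naturals with finitely many
-- nonzero entries) is represented by a finite list a₁ … aₘ; all entries
-- beyond the end of the list are 0.  Positions are 1-based.

range1 : ℕ → List ℕ
range1 k = map suc (upTo k)

nonzeroFrom : ℕ → List ℕ → List (ℕ × ℕ)
nonzeroFrom j []       = []
nonzeroFrom j (x ∷ xs) =
  if x ≡ᵇ 0 then nonzeroFrom (suc j) xs else (j , x) ∷ nonzeroFrom (suc j) xs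

nonzeroPos : List ℕ → List (ℕ × ℕ)
nonzeroPos = nonzeroFrom 1

assocPerm : List ℕ → List ℕ
assocPerm a = map proj₂ (nonzeroPos a)

IsE : List ℕ → Set
IsE a = assocPerm a ↭ range1 (length (assocPerm a))

-- The assignments (a_{j_{i}} , w_{a_{j_i}}) of the map g, following the
-- recurrence; arguments: previous j, previous a_j, previous letter value.
gStep : ℕ → ℕ → ℕ → List (ℕ × ℕ) → List (ℕ × ℕ)
gStep j a w [] = []
gStep j a w ((j' , a') ∷ rest) =
  let w' = if a <ᵇ a' then (w + (j' ∸ j)) ∸ 1 else w + (j' ∸ j)
  in (a' , w') ∷ gStep j' a' w' rest

gAssign : List (ℕ × ℕ) → List (ℕ × ℕ)
gAssign []              = []
gAssign ((j , a) ∷ rest) = (a , j) ∷ gStep j a j rest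

lookupKey : ℕ → List (ℕ × ℕ) → ℕ
lookupKey p []             = 0
lookupKey p ((q , v) ∷ xs) = if p ≡ᵇ q then v else lookupKey p xs

g : List ℕ → List ℕ
g a = map (λ p → lookupKey p (gAssign (nonzeroPos a)))
          (range1 (length (assocPerm a)))

count : {A : Set} → (A → Bool) → List A → ℕ
count P []       = 0
count P (x ∷ xs) = if P x then suc (count P xs) else count P xs

-- Standardization: the letter at (0-based) position i with value x receives
-- 1 + #{letters smaller than x} + #{occurrences of x strictly before i},
-- which is exactly the left-to-right scanning rule.
Std : List ℕ → List ℕ
Std w = map rank indexed
  where
  indexed : List (ℕ × ℕ)
  indexed = zip (upTo (length w)) w
  rank : ℕ × ℕ → ℕ
  rank (i , x) = suc (count (λ p → proj₂ p <ᵇ x) indexed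
                    + count (λ p → (proj₁ p <ᵇ i) ∧ (proj₂ p ≡ᵇ x)) indexed)

positionOf : ℕ → List ℕ → ℕ
positionOf v []       = 0
positionOf v (x ∷ xs) = if v ≡ᵇ x then 1 else suc (positionOf v xs)

inverse : List ℕ → List ℕ
inverse σ = map (λ v → positionOf v σ) (range1 (length σ))

-- Read the pairs (position, letter) assigned by g in the order j₁ < j₂ < … of the nonzero
-- entries of a.  Each step of the recurrence either keeps the letter and moves to a larger
-- position (possible only when a_{j_i} < a_{j_{i+1}}) or strictly increases the letter, so
-- this order is exactly the order in which standardization numbers the letters.  Hence the
-- letter at position σ(i) receives the number i, i.e. Std(g(a)) = σ⁻¹; and σ ↦ σ⁻¹ is
-- injective.
module Submission where

open import Defs
open import Data.Nat using (ℕ; zero; suc; _+_; _∸_; _<ᵇ_; _≡ᵇ_; _<_; _≤_; z≤n; s≤s; >-nonZero)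
open import Data.Nat.Properties
open import Data.Bool using (Bool; true; false; _∧_; if_then_else_)
open import Data.Bool.Properties using (∧-zeroʳ)
open import Data.Empty using (⊥-elim)
open import Data.List using (List; []; _∷_; map; length; upTo; zip)
open import Data.List.Properties
  using (length-map; length-upTo; map-∘; map-id; map-cong-local; ∷-injectiveˡ; ∷-injectiveʳ)
open import Data.List.Membership.Propositional using (_∈_)
open import Data.List.Membership.Propositional.Properties using (∈-map⁺; ∈-map⁻)
open import Data.List.Relation.Binary.Subset.Propositional using (_⊆_)
open import Data.List.Relation.Binary.Permutation.Propositional using (_↭_; ↭-sym; ↭⇒↭ₛ)
import Data.List.Relation.Binary.Permutation.Propositional as ↭
open import Data.List.Relation.Binary.Permutation.Propositional.Properties using (∈-resp-↭)
import Data.List.Relation.Binary.Permutation.Propositional.Properties as ↭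
open import Relation.Binary.PropositionalEquality
  using (_≡_; _≢_; refl; sym; trans; cong; cong₂; subst; subst₂; setoid; module ≡-Reasoning)
open import Data.List.Relation.Binary.Permutation.Setoid.Properties (setoid ℕ) using (Unique-resp-↭)
open import Data.List.Relation.Unary.All as All using (All; []; _∷_)
open import Data.List.Relation.Unary.AllPairs using (AllPairs; []; _∷_)
open import Data.List.Relation.Unary.Any using (here; there)
open import Data.List.Relation.Unary.Linked using (Linked; []; [-]; _∷_)
open import Data.List.Relation.Unary.Linked.Properties using (AllPairs⇒Linked; Linked⇒AllPairs)
open import Data.List.Relation.Unary.Unique.Propositional using (Unique)
import Data.List.Relation.Unary.Unique.Propositional.Properties as Unique
open import Data.Product using (_×_; _,_; proj₁; proj₂)
open import Function using (_∘_; _on_)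
open import Function.Bundles using (_⇔_; mk⇔)
open import Relation.Nullary using (¬_; yes; no)
open import Relation.Nullary.Reflects using (Reflects; ofʸ; ofⁿ; fromEquivalence; det)

open ≡-Reasoning

≡ᵇ-reflects-≡ : ∀ m n → Reflects (m ≡ n) (m ≡ᵇ n)
≡ᵇ-reflects-≡ m n = fromEquivalence (≡ᵇ⇒≡ m n) (≡⇒≡ᵇ m n)

<⇒<ᵇ≡true : ∀ {m n} → m < n → (m <ᵇ n) ≡ true
<⇒<ᵇ≡true m<n = det (<ᵇ-reflects-< _ _) (ofʸ m<n)

≮⇒<ᵇ≡false : ∀ {m n} → ¬ m < n → (m <ᵇ n) ≡ false
≮⇒<ᵇ≡false m≮n = det (<ᵇ-reflects-< _ _) (ofⁿ m≮n)

≡⇒≡ᵇ≡true : ∀ {m n} → m ≡ n → (m ≡ᵇ n) ≡ true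
≡⇒≡ᵇ≡true m≡n = det (≡ᵇ-reflects-≡ _ _) (ofʸ m≡n)

≢⇒≡ᵇ≡false : ∀ {m n} → m ≢ n → (m ≡ᵇ n) ≡ false
≢⇒≡ᵇ≡false m≢n = det (≡ᵇ-reflects-≡ _ _) (ofⁿ m≢n)

count-↭ : ∀ {A : Set} (P : A → Bool) {xs ys} → xs ↭ ys → count P xs ≡ count P ys
count-↭ P ↭.refl = refl
count-↭ P (↭.prep x p) with P x
... | true  = cong suc (count-↭ P p)
... | false = count-↭ P p
count-↭ P (↭.swap x y p) with P x | P y
... | true  | true  = cong (suc ∘ suc) (count-↭ P p)
... | true  | false = cong suc (count-↭ P p)
... | false | true  = cong suc (count-↭ P p)
... | false | false = count-↭ P p
count-↭ P (↭.trans p q) = trans (count-↭ P p) (count-↭ P q)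

count-map : ∀ {A B : Set} (P : B → Bool) (f : A → B) xs → count P (map f xs) ≡ count (P ∘ f) xs
count-map P f [] = refl
count-map P f (x ∷ xs) with P (f x)
... | true  = cong suc (count-map P f xs)
... | false = count-map P f xs

count-≡0 : ∀ {A : Set} (P : A → Bool) {xs} → All (λ x → P x ≡ false) xs → count P xs ≡ 0
count-≡0 P [] = refl
count-≡0 P {x ∷ _} (px ∷ pxs) rewrite px = count-≡0 P pxs

map-≡⇒≡-∈ : ∀ {A B : Set} (f h : A → B) {xs} → map f xs ≡ map h xs → ∀ {x} → x ∈ xs → f x ≡ h x
map-≡⇒≡-∈ f h {_ ∷ _} e (here refl) = ∷-injectiveˡ e
map-≡⇒≡-∈ f h {_ ∷ _} e (there x∈xs) = map-≡⇒≡-∈ f h (∷-injectiveʳ e) x∈xs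

zip-map-self : ∀ (f : ℕ → ℕ) xs → zip xs (map f xs) ≡ map (λ x → (x , f x)) xs
zip-map-self f [] = refl
zip-map-self f (x ∷ xs) = cong ((x , f x) ∷_) (zip-map-self f xs)

unique-range1 : ∀ k → Unique (range1 k)
unique-range1 k = Unique.map⁺ suc-injective (Unique.upTo⁺ k)

length-range1 : ∀ k → length (range1 k) ≡ k
length-range1 k = trans (length-map suc (upTo k)) (length-upTo k)

keys : List (ℕ × ℕ) → List ℕ
keys = map proj₁

lookupKey-∈ : ∀ {x y} T → Unique (keys T) → (x , y) ∈ T → lookupKey x T ≡ y
lookupKey-∈ {x} ((x , y) ∷ _) _ (here refl) rewrite ≡⇒≡ᵇ≡true {x} refl = refl
lookupKey-∈ {x} ((x₀ , _) ∷ T) (x₀∉ ∷ u) (there xy∈T)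
  rewrite ≢⇒≡ᵇ≡false (λ x≡x₀ → All.lookup x₀∉ (∈-map⁺ proj₁ xy∈T) (sym x≡x₀)) = lookupKey-∈ T u xy∈T

-- Pairs are (position , letter); p ≺ q says that standardization numbers p before q.
data _≺_ : ℕ × ℕ → ℕ × ℕ → Set where
  letter<   : ∀ {x y x′ y′} → y < y′ → (x , y) ≺ (x′ , y′)
  position< : ∀ {x y x′} → x < x′ → (x , y) ≺ (x′ , y)

≺-trans : ∀ {p q r} → p ≺ q → q ≺ r → p ≺ r
≺-trans (letter< a)   (letter< b)   = letter< (<-trans a b)
≺-trans (letter< a)   (position< _) = letter< a
≺-trans (position< _) (letter< b)   = letter< b
≺-trans (position< a) (position< b) = position< (<-trans a b)

nonzeroFrom-≥ : ∀ j xs → All (λ p → j ≤ proj₁ p) (nonzeroFrom j xs)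
nonzeroFrom-≥ j [] = []
nonzeroFrom-≥ j (zero ∷ xs) = All.map (≤-trans (n≤1+n j)) (nonzeroFrom-≥ (suc j) xs)
nonzeroFrom-≥ j (suc x ∷ xs) = ≤-refl ∷ All.map (≤-trans (n≤1+n j)) (nonzeroFrom-≥ (suc j) xs)

nonzeroFrom-increasing : ∀ j xs → AllPairs (_<_ on proj₁) (nonzeroFrom j xs)
nonzeroFrom-increasing j [] = []
nonzeroFrom-increasing j (zero ∷ xs) = nonzeroFrom-increasing (suc j) xs
nonzeroFrom-increasing j (suc x ∷ xs) = nonzeroFrom-≥ (suc j) xs ∷ nonzeroFrom-increasing (suc j) xs

nextLetter : ℕ → ℕ → ℕ → ℕ → ℕ → ℕ
nextLetter j a w j′ a′ = if a <ᵇ a′ then (w + (j′ ∸ j)) ∸ 1 else w + (j′ ∸ j)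

≺-raise : ∀ {a a′} w → a < a′ → ∀ e → (a , w) ≺ (a′ , w + e)
≺-raise w a<a′ zero rewrite +-identityʳ w = position< a<a′
≺-raise w a<a′ (suc e) = letter< (m<m+n w (s≤s z≤n))

≺-nextLetter : ∀ {j j′} a a′ w → j < j′ → (a , w) ≺ (a′ , nextLetter j a w j′ a′)
≺-nextLetter {j} {j′} a a′ w j<j′ with a <ᵇ a′ | <ᵇ-reflects-< a a′
... | true  | ofʸ a<a′ rewrite +-∸-assoc w {j′ ∸ j} (m<n⇒0<n∸m j<j′) = ≺-raise w a<a′ _
... | false | ofⁿ _ = letter< (m<m+n w (m<n⇒0<n∸m j<j′))

gStep-sorted : ∀ j a w rest → Linked (_<_ on proj₁) ((j , a) ∷ rest) →
               Linked _≺_ ((a , w) ∷ gStep j a w rest)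
gStep-sorted j a w [] _ = [-]
gStep-sorted j a w ((j′ , a′) ∷ rest) (j<j′ ∷ l) =
  ≺-nextLetter a a′ w j<j′ ∷ gStep-sorted j′ a′ _ rest l

gAssign-sorted : ∀ L → Linked (_<_ on proj₁) L → Linked _≺_ (gAssign L)
gAssign-sorted [] _ = []
gAssign-sorted ((j , a) ∷ rest) l = gStep-sorted j a j rest l

keys-gStep : ∀ j a w rest → keys (gStep j a w rest) ≡ map proj₂ rest
keys-gStep j a w [] = refl
keys-gStep j a w ((j′ , a′) ∷ rest) = cong (a′ ∷_) (keys-gStep j′ a′ _ rest)

keys-gAssign : ∀ L → keys (gAssign L) ≡ map proj₂ L
keys-gAssign [] = refl
keys-gAssign ((j , a) ∷ rest) = cong (a ∷_) (keys-gStep j a j rest)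

smallerLetter : ℕ → ℕ × ℕ → Bool
smallerLetter y p = proj₂ p <ᵇ y

earlierEqualLetter : ℕ → ℕ → ℕ × ℕ → Bool
earlierEqualLetter i y p = (proj₁ p <ᵇ i) ∧ (proj₂ p ≡ᵇ y)

-- g numbers positions from 1, Std from 0.
toZeroBased : ℕ × ℕ → ℕ × ℕ
toZeroBased p = (proj₁ p ∸ 1 , proj₂ p)

earlierEqualLetter₁ : ℕ → ℕ → ℕ × ℕ → Bool
earlierEqualLetter₁ x y = earlierEqualLetter (x ∸ 1) y ∘ toZeroBased

≺⇒¬smallerLetter : ∀ {x y q} → (x , y) ≺ q → smallerLetter y q ≡ false
≺⇒¬smallerLetter (letter< y<y′) = ≮⇒<ᵇ≡false (<⇒≯ y<y′)
≺⇒¬smallerLetter {y = y} (position< _) = ≮⇒<ᵇ≡false (<-irrefl (refl {x = y}))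

≺⇒¬earlierEqualLetter₁ : ∀ {x y q} → (x , y) ≺ q → earlierEqualLetter₁ x y q ≡ false
≺⇒¬earlierEqualLetter₁ {x} {q = x′ , _} (letter< y<y′)
  rewrite ≢⇒≡ᵇ≡false (λ y′≡y → <-irrefl (sym y′≡y) y<y′) = ∧-zeroʳ ((x′ ∸ 1) <ᵇ (x ∸ 1))
≺⇒¬earlierEqualLetter₁ (position< x<x′) rewrite ≮⇒<ᵇ≡false (≤⇒≯ (∸-monoˡ-≤ 1 (<⇒≤ x<x′))) = refl

-- In a ≺-sorted table, (x , y) is preceded exactly by the smaller letters and by the
-- earlier occurrences of y.
rank-sorted : ∀ {x y} T → AllPairs _≺_ T → Unique (keys T) → All (λ p → 1 ≤ proj₁ p) T →
              (x , y) ∈ T →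
              suc (count (smallerLetter y) T + count (earlierEqualLetter₁ x y) T) ≡ positionOf x (keys T)
rank-sorted {x} {y} ((x , y) ∷ T) (above ∷ _) _ _ (here refl)
  rewrite ≮⇒<ᵇ≡false (<-irrefl (refl {x = y})) | ≮⇒<ᵇ≡false (<-irrefl (refl {x = x ∸ 1}))
        | ≡⇒≡ᵇ≡true (refl {x = x})
        | count-≡0 (smallerLetter y) (All.map ≺⇒¬smallerLetter above)
        | count-≡0 (earlierEqualLetter₁ x y) (All.map ≺⇒¬earlierEqualLetter₁ above) = refl
rank-sorted {x} {y} ((x₀ , y₀) ∷ T) (above ∷ sorted) (x₀∉ ∷ u) (x₀≥1 ∷ ≥1) (there xy∈T)
  rewrite ≢⇒≡ᵇ≡false (λ x≡x₀ → All.lookup x₀∉ (∈-map⁺ proj₁ xy∈T) (sym x≡x₀)) =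
  earlier (All.lookup above xy∈T)
  where
  ih : suc (count (smallerLetter y) T + count (earlierEqualLetter₁ x y) T) ≡ positionOf x (keys T)
  ih = rank-sorted T sorted u ≥1 xy∈T
  earlier : (x₀ , y₀) ≺ (x , y) →
            suc (count (smallerLetter y) ((x₀ , y₀) ∷ T) + count (earlierEqualLetter₁ x y) ((x₀ , y₀) ∷ T))
            ≡ suc (positionOf x (keys T))
  earlier (letter< y₀<y)
    rewrite <⇒<ᵇ≡true y₀<y | ≢⇒≡ᵇ≡false (λ y₀≡y → <-irrefl y₀≡y y₀<y)
          | ∧-zeroʳ ((x₀ ∸ 1) <ᵇ (x ∸ 1)) = cong suc ih
  earlier (position< x₀<x)
    rewrite ≮⇒<ᵇ≡false (<-irrefl (refl {x = y})) | <⇒<ᵇ≡true (pred-mono-< ⦃ >-nonZero x₀≥1 ⦄ x₀<x)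
          | ≡⇒≡ᵇ≡true (refl {x = y}) = cong suc (trans (+-suc _ _) ih)

indexed : List ℕ → List (ℕ × ℕ)
indexed w = zip (upTo (length w)) w

rank : List ℕ → ℕ × ℕ → ℕ
rank w (i , x) = suc (count (smallerLetter x) (indexed w) + count (earlierEqualLetter i x) (indexed w))

readOff : List (ℕ × ℕ) → ℕ → List ℕ
readOff T k = map (λ p → lookupKey p T) (range1 k)

module ReadOff (T : List (ℕ × ℕ)) (isPerm : keys T ↭ range1 (length (keys T))) where

  σ : List ℕ
  σ = keys T

  k : ℕ
  k = length σ

  w : List ℕ
  w = readOff T k

  keys-unique : Unique σ
  keys-unique = Unique-resp-↭ (↭⇒↭ₛ (↭-sym isPerm)) (unique-range1 k)

  keys-positive : All (λ p → 1 ≤ proj₁ p) T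
  keys-positive = All.tabulate positive
    where
    positive : ∀ {p} → p ∈ T → 1 ≤ proj₁ p
    positive p∈T with ∈-map⁻ suc (∈-resp-↭ isPerm (∈-map⁺ proj₁ p∈T))
    ... | _ , _ , refl = s≤s z≤n

  letterAt : ℕ → ℕ × ℕ
  letterAt i = (i , lookupKey (suc i) T)

  indexed-readOff : indexed w ≡ map letterAt (upTo k)
  indexed-readOff = begin
    zip (upTo (length w)) w
      ≡⟨ cong (λ n → zip (upTo n) w) (trans (length-map _ (range1 k)) (length-range1 k)) ⟩
    zip (upTo k) w
      ≡⟨ cong (zip (upTo k)) (sym (map-∘ (upTo k))) ⟩
    zip (upTo k) (map (λ i → lookupKey (suc i) T) (upTo k))
      ≡⟨ zip-map-self (λ i → lookupKey (suc i) T) (upTo k) ⟩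
    map letterAt (upTo k) ∎

  toZeroBased-letterAt : ∀ {p} → p ∈ T → letterAt (proj₁ p ∸ 1) ≡ toZeroBased p
  toZeroBased-letterAt {suc x , y} p∈T = cong (x ,_) (lookupKey-∈ T keys-unique p∈T)
  toZeroBased-letterAt {zero , y} p∈T with () ← All.lookup keys-positive p∈T

  indexed-readOff-↭ : map toZeroBased T ↭ indexed w
  indexed-readOff-↭ = subst₂ _↭_ toZeroBased-T (sym indexed-readOff) (↭.map⁺ letterAt positions-↭)
    where
    positions-↭ : map (_∸ 1) σ ↭ upTo k
    positions-↭ = subst (map (_∸ 1) σ ↭_) (trans (sym (map-∘ (upTo k))) (map-id (upTo k)))
                        (↭.map⁺ (_∸ 1) isPerm)
    toZeroBased-T : map letterAt (map (_∸ 1) σ) ≡ map toZeroBased T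
    toZeroBased-T = begin
      map letterAt (map (_∸ 1) (map proj₁ T)) ≡⟨ cong (map letterAt) (sym (map-∘ T)) ⟩
      map letterAt (map ((_∸ 1) ∘ proj₁) T)   ≡⟨ sym (map-∘ T) ⟩
      map (letterAt ∘ (_∸ 1) ∘ proj₁) T       ≡⟨ map-cong-local (All.tabulate toZeroBased-letterAt) ⟩
      map toZeroBased T ∎

  count-indexed : ∀ P → count P (indexed w) ≡ count (P ∘ toZeroBased) T
  count-indexed P = trans (count-↭ P (↭-sym indexed-readOff-↭)) (count-map P toZeroBased T)

  Std-readOff : AllPairs _≺_ T → Std w ≡ inverse σ
  Std-readOff sorted = begin
    Std w                                   ≡⟨⟩
    map (rank w) (indexed w)                ≡⟨ cong (map (rank w)) indexed-readOff ⟩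
    map (rank w) (map letterAt (upTo k))    ≡⟨ sym (map-∘ (upTo k)) ⟩
    map (rank w ∘ letterAt) (upTo k)        ≡⟨ map-cong-local (All.tabulate rank-letterAt) ⟩
    map (λ i → positionOf (suc i) σ) (upTo k) ≡⟨ map-∘ (upTo k) ⟩
    inverse σ ∎
    where
    rank-letterAt : ∀ {i} → i ∈ upTo k → rank w (letterAt i) ≡ positionOf (suc i) σ
    rank-letterAt {i} i∈ with ∈-map⁻ proj₁ (∈-resp-↭ (↭-sym isPerm) (∈-map⁺ suc i∈))
    ... | (x , y) , xy∈T , refl = begin
      rank w (i , lookupKey (suc i) T)
        ≡⟨ cong (λ v → rank w (i , v)) (lookupKey-∈ T keys-unique xy∈T) ⟩
      suc (count (smallerLetter y) (indexed w) + count (earlierEqualLetter i y) (indexed w))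
        ≡⟨ cong₂ (λ c d → suc (c + d)) (count-indexed (smallerLetter y))
                                        (count-indexed (earlierEqualLetter i y)) ⟩
      suc (count (smallerLetter y) T + count (earlierEqualLetter₁ (suc i) y) T)
        ≡⟨ rank-sorted T sorted keys-unique keys-positive xy∈T ⟩
      positionOf (suc i) σ ∎

Std-readOff : ∀ T σ → keys T ≡ σ → σ ↭ range1 (length σ) → AllPairs _≺_ T →
              Std (readOff T (length σ)) ≡ inverse σ
Std-readOff T _ refl isPerm = ReadOff.Std-readOff T isPerm

Std-g : (a : List ℕ) → IsE a → Std (g a) ≡ inverse (assocPerm a)
Std-g a isE = Std-readOff (gAssign L) (assocPerm a) (keys-gAssign L) isE
  (Linked⇒AllPairs ≺-trans (gAssign-sorted L (AllPairs⇒Linked (nonzeroFrom-increasing 1 a))))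
  where
  L : List (ℕ × ℕ)
  L = nonzeroPos a

positionOf-here : ∀ v xs → positionOf v (v ∷ xs) ≡ 1
positionOf-here v xs rewrite ≡⇒≡ᵇ≡true (refl {x = v}) = refl

positionOf-there : ∀ {v x} xs → v ≢ x → positionOf v (x ∷ xs) ≡ suc (positionOf v xs)
positionOf-there xs v≢x rewrite ≢⇒≡ᵇ≡false v≢x = refl

positionOf-∈ : ∀ {v xs} → v ∈ xs → 0 < positionOf v xs
positionOf-∈ {v} {x ∷ _} _ with v ≡ᵇ x
... | true  = s≤s z≤n
... | false = s≤s z≤n

≡-fromPositions : ∀ {xs ys} → Unique xs → xs ⊆ ys → length xs ≡ length ys →
                  (∀ {v} → v ∈ xs → positionOf v xs ≡ positionOf v ys) → xs ≡ ys
≡-fromPositions {[]} {[]} _ _ _ _ = refl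
≡-fromPositions {x ∷ xs} {y ∷ ys} (x∉ ∷ u) xs⊆ys len pos with x ≟ y
... | yes refl = cong (x ∷_) (≡-fromPositions u xs⊆ys′ (suc-injective len) pos′)
  where
  x≢ : ∀ {v} → v ∈ xs → v ≢ x
  x≢ v∈xs v≡x = All.lookup x∉ v∈xs (sym v≡x)
  xs⊆ys′ : xs ⊆ ys
  xs⊆ys′ v∈xs with xs⊆ys (there v∈xs)
  ... | here v≡x = ⊥-elim (x≢ v∈xs v≡x)
  ... | there v∈ys = v∈ys
  pos′ : ∀ {v} → v ∈ xs → positionOf v xs ≡ positionOf v ys
  pos′ {v} v∈xs = suc-injective (begin
    suc (positionOf v xs) ≡⟨ sym (positionOf-there xs (x≢ v∈xs)) ⟩
    positionOf v (x ∷ xs) ≡⟨ pos (there v∈xs) ⟩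
    positionOf v (x ∷ ys) ≡⟨ positionOf-there ys (x≢ v∈xs) ⟩
    suc (positionOf v ys) ∎)
... | no x≢y = ⊥-elim (<-irrefl (sym x∉ys) (positionOf-∈ x∈ys))
  where
  x∈ys : x ∈ ys
  x∈ys with xs⊆ys (here refl)
  ... | here x≡y = ⊥-elim (x≢y x≡y)
  ... | there x∈ys = x∈ys
  x∉ys : positionOf x ys ≡ 0
  x∉ys = suc-injective (begin
    suc (positionOf x ys) ≡⟨ sym (positionOf-there ys x≢y) ⟩
    positionOf x (y ∷ ys) ≡⟨ sym (pos (here refl)) ⟩
    positionOf x (x ∷ xs) ≡⟨ positionOf-here x xs ⟩
    1 ∎)

length-inverse : ∀ σ → length (inverse σ) ≡ length σ
length-inverse σ = trans (length-map _ (range1 (length σ))) (length-range1 (length σ))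

inverse-injective : ∀ σ τ → σ ↭ range1 (length σ) → τ ↭ range1 (length τ) →
                    inverse σ ≡ inverse τ → σ ≡ τ
inverse-injective σ τ σ-perm τ-perm σ⁻¹≡τ⁻¹ =
  ≡-fromPositions (Unique-resp-↭ (↭⇒↭ₛ (↭-sym σ-perm)) (unique-range1 (length σ))) σ⊆τ len positions
  where
  len : length σ ≡ length τ
  len = trans (sym (length-inverse σ)) (trans (cong length σ⁻¹≡τ⁻¹) (length-inverse τ))
  σ⊆τ : σ ⊆ τ
  σ⊆τ {v} v∈σ = ∈-resp-↭ (↭-sym τ-perm) (subst (λ n → v ∈ range1 n) len (∈-resp-↭ σ-perm v∈σ))
  positions : ∀ {v} → v ∈ σ → positionOf v σ ≡ positionOf v τ
  positions v∈σ = map-≡⇒≡-∈ (λ v → positionOf v σ) (λ v → positionOf v τ)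
    (trans σ⁻¹≡τ⁻¹ (cong (λ n → map (λ v → positionOf v τ) (range1 n)) (sym len)))
    (∈-resp-↭ σ-perm v∈σ)

mainTheorem7 : ((a : List ℕ) → IsE a → Std (g a) ≡ inverse (assocPerm a))
    × ((a b : List ℕ) → IsE a → IsE b → (Std (g a) ≡ Std (g b) ⇔ assocPerm a ≡ assocPerm b))
mainTheorem7 = Std-g , λ a b a∈E b∈E → mk⇔
  (λ Std≡ → inverse-injective (assocPerm a) (assocPerm b) a∈E b∈E (begin
    inverse (assocPerm a) ≡⟨ sym (Std-g a a∈E) ⟩
    Std (g a)             ≡⟨ Std≡ ⟩
    Std (g b)             ≡⟨ Std-g b b∈E ⟩
    inverse (assocPerm b) ∎))
  (λ σ≡τ → begin
    Std (g a)             ≡⟨ Std-g a a∈E ⟩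
    inverse (assocPerm a) ≡⟨ cong inverse σ≡τ ⟩
    inverse (assocPerm b) ≡⟨ sym (Std-g b b∈E) ⟩
    Std (g b)             ∎)
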